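{- Every graph $G$ with layered treewidth $k$ has a domino path decomposition $P$ and a tree decomposition $T$ such that for every vertex $v$ of $G$, if $G_v$ is the subgraph of $G$ induced by the union of the bags of $P$ that contain $v$, then $T$ restricted to $G_v$ has width at most $3k-1$.
   Context: A tree decomposition of $G$ is a tree with bags $T_x\subseteq V(G)$ such that every edge has both ends in some bag and for every vertex the nodes whose bags contain it induce a non-empty connected subtree; its width is $\max_x|T_x|-1$. A path decomposition is a tree decomposition whose tree is a path. A tree decomposition is domino if every vertex lies in at most two bags. $T$ restricted to $G_v$ is the decomposition with bags $T_x\cap V(G_v)$. A layering of $G$ is a partition $(V_0,\dots,V_t)$ of $V(G)$ such that for each edge $vw$ with $v\in V_i$, $w\in V_j$, $|i-j|\le1$. The layered width of a tree decomposition is the minimum $\ell$ such that for some layering each bag contains at most $\ell$ vertices of each layer; the layered treewidth of $G$ is the minimum layered width of a tree decomposition of $G$. -}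

module Defs where

open import Data.Nat using (ℕ; zero; suc; _≤_; _<_)
open import Data.Fin using (Fin; zero; suc; toℕ)
open import Data.Fin.Subset using (Subset; _∈_; _∩_; ∣_∣)
open import Data.Bool using (Bool; _∧_)
open import Data.Vec using (lookup; tabulate)
open import Data.List using (allFin)
open import Data.Bool.ListAction using (any)
open import Data.Product using (Σ; ∃; _×_)
open import Data.Sum using (_⊎_)
open import Data.Empty using (⊥)
open import Relation.Nullary using (¬_)
open import Relation.Nullary.Decidable using (⌊_⌋)
open import Relation.Binary.PropositionalEquality using (_≡_)
import Data.Nat as ℕ

record Graph : Set₁ where
  field
    n      : ℕ
    E      : Fin n → Fin n → Set
    sym    : ∀ {u v} → E u v → E v u
    irrefl : ∀ {u} → ¬ E u u

data Walk {N : ℕ} (R : Fin N → Fin N → Set) (P : Fin N → Set) : Fin N → Fin N → Set where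
  here : ∀ {x} → P x → Walk R P x x
  step : ∀ {x y z} → P x → R x y → Walk R P y z → Walk R P x z

record IsDecomp (G : Graph) {N : ℕ} (TAdj : Fin N → Fin N → Set)
                (bag : Fin N → Subset (Graph.n G)) : Set where
  open Graph G
  field
    edgeCovered : ∀ u v → E u v → ∃ λ x → u ∈ bag x × v ∈ bag x
    vertexCovered : ∀ v → ∃ λ x → v ∈ bag x
    connected : ∀ v x y → v ∈ bag x → v ∈ bag y → Walk TAdj (λ z → v ∈ bag z) x y

-- A tree on nodes Fin (suc m): node (suc i) has parent (parent i) with a
-- smaller index.  Every finite non-empty tree has such a labelling.
TreeAdj : ∀ {m} → (Fin m → Fin (suc m)) → Fin (suc m) → Fin (suc m) → Set
TreeAdj {m} parent x y =
  (∃ λ (i : Fin m) → x ≡ suc i × y ≡ parent i) ⊎ (∃ λ (i : Fin m) → y ≡ suc i × x ≡ parent i)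

record TreeDecomp (G : Graph) : Set where
  field
    m        : ℕ
    parent   : Fin m → Fin (suc m)
    parentLt : ∀ i → toℕ (parent i) ≤ toℕ i
    bag      : Fin (suc m) → Subset (Graph.n G)
    isDecomp : IsDecomp G (TreeAdj parent) bag

PathAdj : ∀ {N} → Fin N → Fin N → Set
PathAdj x y = toℕ y ≡ suc (toℕ x) ⊎ toℕ x ≡ suc (toℕ y)

record PathDecomp (G : Graph) : Set where
  field
    m        : ℕ
    bag      : Fin (suc m) → Subset (Graph.n G)
    isDecomp : IsDecomp G PathAdj bag

-- Domino: each vertex lies in at most two bags.
Domino : ∀ {G} → PathDecomp G → Set
Domino {G} P = ∀ (v : Fin (Graph.n G)) x y z →
  v ∈ bag x → v ∈ bag y → v ∈ bag z → x ≡ y ⊎ y ≡ z ⊎ x ≡ z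
  where open PathDecomp P

IsLayering : (G : Graph) → (Fin (Graph.n G) → ℕ) → Set
IsLayering G layer = ∀ u v → Graph.E G u v →
  layer u ≡ layer v ⊎ layer v ≡ suc (layer u) ⊎ layer u ≡ suc (layer v)

layerSet : ∀ {n} → (Fin n → ℕ) → ℕ → Subset n
layerSet layer i = tabulate (λ v → ⌊ layer v ℕ.≟ i ⌋)

LayeredWidth≤ : ∀ {G} → TreeDecomp G → ℕ → Set
LayeredWidth≤ {G} T ℓ = Σ (Fin (Graph.n G) → ℕ) λ layer →
  IsLayering G layer × (∀ x i → ∣ TreeDecomp.bag T x ∩ layerSet layer i ∣ ≤ ℓ)

LTW≤ : Graph → ℕ → Set
LTW≤ G ℓ = Σ (TreeDecomp G) λ T → LayeredWidth≤ T ℓ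

LayeredTreewidth : Graph → ℕ → Set
LayeredTreewidth G k = LTW≤ G k × (∀ ℓ → ℓ < k → ¬ LTW≤ G ℓ)

-- V(G_v): union of the bags of P containing v.
Gv : ∀ {G} → PathDecomp G → Fin (Graph.n G) → Subset (Graph.n G)
Gv P v = tabulate (λ w → any (λ x → lookup (bag x) v ∧ lookup (bag x) w) (allFin (suc m)))
  where open PathDecomp P

module Submission where

-- Let (T, layer) witness layered width k: every bag of T meets every layer
-- in at most k vertices.  Keep T, and take for P the path decomposition
-- whose i-th bag is the "window" V_i ∪ V_{i+1} of two consecutive layers
-- (i = 0 … top layer).  Edges join equal or consecutive layers, so some
-- window covers every edge; a vertex of layer L lies exactly in windows
-- L-1 and L, which are consecutive (so P is a path decomposition) and at
-- most two (so P is domino).  Two vertices sharing a window have layers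
-- differing by at most one, so V(G_v) ⊆ V_{L-1} ∪ V_L ∪ V_{L+1}; hence
-- every bag of T meets V(G_v) in at most 3k vertices, i.e. T restricted
-- to G_v has width at most 3k-1.

open import Defs
open import Data.Nat using (ℕ; suc; _≤_; _+_; _*_; _∸_; z≤n; s≤s)
open import Data.Nat.Properties using (≤-refl; ≤-trans; ≤-reflexive; +-mono-≤; +-monoʳ-≤; +-suc; n≤1+n; module ≤-Reasoning)
open import Data.Nat.Tactic.RingSolver using (solve-∀)
open import Data.Fin using (Fin; toℕ; fromℕ<)
open import Data.Fin.Properties using (toℕ-injective; toℕ-fromℕ<)
open import Data.Fin.Subset using (Subset; inside; outside; _∈_; _⊆_; _∩_; _∪_; ∣_∣)
open import Data.Fin.Subset.Properties using (x∈p∩q⁺; x∈p∩q⁻; x∈p∪q⁺; x∈p∪q⁻; p⊆q⇒∣p∣≤∣q∣; ∩-distribˡ-∪)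
open import Data.Bool using (Bool; T)
open import Data.Bool.Properties using (T-≡; T-∧)
open import Data.Vec using (_∷_; []; lookup; tabulate)
open import Data.Vec.Properties using ([]=⇒lookup; lookup⇒[]=; lookup∘tabulate)
open import Data.List using (allFin; map)
open import Data.List.Extrema.Nat using (max; xs≤max)
open import Data.List.Membership.Propositional.Properties using (∈-allFin)
open import Data.List.Relation.Unary.Any using (satisfied)
open import Data.List.Relation.Unary.Any.Properties using (any⁻)
import Data.List.Relation.Unary.All as All
open import Data.List.Relation.Unary.All.Properties using (map⁻)
open import Data.Product using (Σ; ∃; _×_; _,_)
open import Data.Sum using (_⊎_; inj₁; inj₂)
import Data.Sum as Sum
open import Data.Unit using (tt)
open import Function using (_∘_)
open import Function.Bundles using (Equivalence)
open import Relation.Nullary.Decidable using (toWitness; fromWitness)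
open import Relation.Binary.PropositionalEquality using (_≡_; refl; sym; trans; cong; subst)

private
  variable
    n : ℕ

T-lookup⁺ : {p : Subset n} {w : Fin n} → w ∈ p → T (lookup p w)
T-lookup⁺ w∈p rewrite []=⇒lookup w∈p = tt

T-lookup⁻ : (p : Subset n) (w : Fin n) → T (lookup p w) → w ∈ p
T-lookup⁻ p w t = lookup⇒[]= w p (Equivalence.to T-≡ t)

∈-tabulate⁺ : (f : Fin n → Bool) {w : Fin n} → T (f w) → w ∈ tabulate f
∈-tabulate⁺ f {w} t = T-lookup⁻ (tabulate f) w (subst T (sym (lookup∘tabulate f w)) t)

∈-tabulate⁻ : (f : Fin n → Bool) {w : Fin n} → w ∈ tabulate f → T (f w)
∈-tabulate⁻ f {w} w∈ = subst T (lookup∘tabulate f w) (T-lookup⁺ w∈)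

∣p∪q∣≤∣p∣+∣q∣ : (p q : Subset n) → ∣ p ∪ q ∣ ≤ ∣ p ∣ + ∣ q ∣
∣p∪q∣≤∣p∣+∣q∣ []            []            = z≤n
∣p∪q∣≤∣p∣+∣q∣ (outside ∷ p) (outside ∷ q) = ∣p∪q∣≤∣p∣+∣q∣ p q
∣p∪q∣≤∣p∣+∣q∣ (outside ∷ p) (inside ∷ q)  =
  ≤-trans (s≤s (∣p∪q∣≤∣p∣+∣q∣ p q)) (≤-reflexive (sym (+-suc ∣ p ∣ ∣ q ∣)))
∣p∪q∣≤∣p∣+∣q∣ (inside ∷ p)  (outside ∷ q) = s≤s (∣p∪q∣≤∣p∣+∣q∣ p q)
∣p∪q∣≤∣p∣+∣q∣ (inside ∷ p)  (inside ∷ q)  =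
  s≤s (≤-trans (∣p∪q∣≤∣p∣+∣q∣ p q) (+-monoʳ-≤ ∣ p ∣ (n≤1+n ∣ q ∣)))

∣B∩[p∪q]∣≤ : (B p q : Subset n) → ∣ B ∩ (p ∪ q) ∣ ≤ ∣ B ∩ p ∣ + ∣ B ∩ q ∣
∣B∩[p∪q]∣≤ B p q rewrite ∩-distribˡ-∪ B p q = ∣p∪q∣≤∣p∣+∣q∣ (B ∩ p) (B ∩ q)

∣B∩p∣≤∣B∩q∣ : (B : Subset n) {p q : Subset n} → p ⊆ q → ∣ B ∩ p ∣ ≤ ∣ B ∩ q ∣
∣B∩p∣≤∣B∩q∣ B {p} p⊆q = p⊆q⇒∣p∣≤∣q∣ λ w∈ →
  let (w∈B , w∈p) = x∈p∩q⁻ B p w∈ in x∈p∩q⁺ (w∈B , p⊆q w∈p)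

∈-layerSet⁺ : (layer : Fin n → ℕ) {i : ℕ} {w : Fin n} → layer w ≡ i → w ∈ layerSet layer i
∈-layerSet⁺ layer e = ∈-tabulate⁺ _ (fromWitness e)

∈-layerSet⁻ : (layer : Fin n → ℕ) {i : ℕ} {w : Fin n} → w ∈ layerSet layer i → layer w ≡ i
∈-layerSet⁻ layer w∈ = toWitness (∈-tabulate⁻ _ w∈)

InWindow : ℕ → ℕ → Set
InWindow l i = l ≡ i ⊎ l ≡ suc i

window : (Fin n → ℕ) → ℕ → Subset n
window layer i = layerSet layer i ∪ layerSet layer (suc i)

∈-window⁺ : (layer : Fin n → ℕ) {i : ℕ} {w : Fin n} → InWindow (layer w) i → w ∈ window layer i
∈-window⁺ layer = x∈p∪q⁺ ∘ Sum.map (∈-layerSet⁺ layer) (∈-layerSet⁺ layer)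

∈-window⁻ : (layer : Fin n → ℕ) {i : ℕ} {w : Fin n} → w ∈ window layer i → InWindow (layer w) i
∈-window⁻ layer {i} w∈ =
  Sum.map (∈-layerSet⁻ layer) (∈-layerSet⁻ layer) (x∈p∪q⁻ (layerSet layer i) _ w∈)

nearLayers : (Fin n → ℕ) → ℕ → Subset n
nearLayers layer L = (layerSet layer (L ∸ 1) ∪ layerSet layer L) ∪ layerSet layer (suc L)

∈-Gv⁻ : ∀ {G} (P : PathDecomp G) {v w : Fin (Graph.n G)} → w ∈ Gv P v →
  ∃ λ x → v ∈ PathDecomp.bag P x × w ∈ PathDecomp.bag P x
∈-Gv⁻ P {v} {w} w∈ with satisfied (any⁻ _ (allFin _) (∈-tabulate⁻ _ w∈))
... | x , t with Equivalence.to T-∧ t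
...   | tv , tw = x , T-lookup⁻ (PathDecomp.bag P x) v tv , T-lookup⁻ (PathDecomp.bag P x) w tw

∈-nearLayers⁺ : (layer : Fin n → ℕ) {L : ℕ} {w : Fin n} →
  layer w ≡ L ∸ 1 ⊎ layer w ≡ L ⊎ layer w ≡ suc L → w ∈ nearLayers layer L
∈-nearLayers⁺ layer (inj₁ e)        = x∈p∪q⁺ (inj₁ (x∈p∪q⁺ (inj₁ (∈-layerSet⁺ layer e))))
∈-nearLayers⁺ layer (inj₂ (inj₁ e)) = x∈p∪q⁺ (inj₁ (x∈p∪q⁺ (inj₂ (∈-layerSet⁺ layer e))))
∈-nearLayers⁺ layer (inj₂ (inj₂ e)) = x∈p∪q⁺ (inj₂ (∈-layerSet⁺ layer e))

windows-of-layer : ∀ {l a b} → InWindow l a → InWindow l b → a ≡ b ⊎ b ≡ suc a ⊎ a ≡ suc b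
windows-of-layer (inj₁ refl) (inj₁ refl) = inj₁ refl
windows-of-layer (inj₁ refl) (inj₂ refl) = inj₂ (inj₂ refl)
windows-of-layer (inj₂ refl) (inj₁ refl) = inj₂ (inj₁ refl)
windows-of-layer (inj₂ refl) (inj₂ refl) = inj₁ refl

-- A layer lies in only two windows, so among three of them two coincide.
windows-pigeonhole : ∀ {l a b c} → InWindow l a → InWindow l b → InWindow l c →
  a ≡ b ⊎ b ≡ c ⊎ a ≡ c
windows-pigeonhole (inj₁ refl) (inj₁ refl) _           = inj₁ refl
windows-pigeonhole (inj₂ refl) (inj₂ refl) _           = inj₁ refl
windows-pigeonhole (inj₁ refl) (inj₂ refl) (inj₁ refl) = inj₂ (inj₂ refl)
windows-pigeonhole (inj₁ refl) (inj₂ refl) (inj₂ refl) = inj₂ (inj₁ refl)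
windows-pigeonhole (inj₂ refl) (inj₁ refl) (inj₁ refl) = inj₂ (inj₁ refl)
windows-pigeonhole (inj₂ refl) (inj₁ refl) (inj₂ refl) = inj₂ (inj₂ refl)

common-window : ∀ {a b i} → InWindow a i → InWindow b i → b ≡ a ∸ 1 ⊎ b ≡ a ⊎ b ≡ suc a
common-window (inj₁ refl) (inj₁ refl) = inj₂ (inj₁ refl)
common-window (inj₁ refl) (inj₂ refl) = inj₂ (inj₂ refl)
common-window (inj₂ refl) (inj₁ refl) = inj₁ refl
common-window (inj₂ refl) (inj₂ refl) = inj₂ (inj₁ refl)

module WindowPath (G : Graph) (layer : Fin (Graph.n G) → ℕ) (isLayering : IsLayering G layer) where
  open Graph G using (E)

  -- The largest layer index; the windows 0 … top cover every layer.
  -- Only its defining bound matters, so it is kept opaque.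
  opaque
    top : ℕ
    top = max 0 (map layer (allFin (Graph.n G)))

    layer≤top : ∀ v → layer v ≤ top
    layer≤top v = All.lookup (map⁻ (xs≤max 0 (map layer (allFin (Graph.n G))))) (∈-allFin v)

  lowerWindow : Fin (Graph.n G) → Fin (suc top)
  lowerWindow v = fromℕ< (s≤s (layer≤top v))

  layer≡lowerWindow : ∀ v → layer v ≡ toℕ (lowerWindow v)
  layer≡lowerWindow v = sym (toℕ-fromℕ< (s≤s (layer≤top v)))

  bag : Fin (suc top) → Subset (Graph.n G)
  bag x = window layer (toℕ x)

  ∈-lowerWindow : ∀ {u v} → InWindow (layer v) (layer u) → v ∈ bag (lowerWindow u)
  ∈-lowerWindow {u} (inj₁ e) = ∈-window⁺ layer (inj₁ (trans e (layer≡lowerWindow u)))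
  ∈-lowerWindow {u} (inj₂ e) = ∈-window⁺ layer (inj₂ (trans e (cong suc (layer≡lowerWindow u))))

  edgeCovered : ∀ u v → E u v → ∃ λ x → u ∈ bag x × v ∈ bag x
  edgeCovered u v e with isLayering u v e
  ... | inj₁ eq        = lowerWindow u , ∈-lowerWindow (inj₁ refl) , ∈-lowerWindow (inj₁ (sym eq))
  ... | inj₂ (inj₁ eq) = lowerWindow u , ∈-lowerWindow (inj₁ refl) , ∈-lowerWindow (inj₂ eq)
  ... | inj₂ (inj₂ eq) = lowerWindow v , ∈-lowerWindow (inj₂ eq) , ∈-lowerWindow (inj₁ refl)

  -- The (at most two) windows containing v are consecutive.
  connected : ∀ v x y → v ∈ bag x → v ∈ bag y → Walk PathAdj (λ z → v ∈ bag z) x y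
  connected v x y v∈x v∈y with windows-of-layer (∈-window⁻ layer v∈x) (∈-window⁻ layer v∈y)
  ... | inj₂ x~y = step v∈x x~y (here v∈y)
  ... | inj₁ x≡y with toℕ-injective x≡y
  ...   | refl = here v∈x

  path : PathDecomp G
  path = record
    { m        = top
    ; bag      = bag
    ; isDecomp = record
      { edgeCovered   = edgeCovered
      ; vertexCovered = λ v → lowerWindow v , ∈-lowerWindow (inj₁ refl)
      ; connected     = connected
      }
    }

  domino : Domino path
  domino v x y z v∈x v∈y v∈z =
    Sum.map toℕ-injective (Sum.map toℕ-injective toℕ-injective)
      (windows-pigeonhole (∈-window⁻ layer v∈x) (∈-window⁻ layer v∈y) (∈-window⁻ layer v∈z))

  Gv⊆nearLayers : ∀ v → Gv path v ⊆ nearLayers layer (layer v)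
  Gv⊆nearLayers v w∈ with ∈-Gv⁻ path w∈
  ... | x , v∈x , w∈x = ∈-nearLayers⁺ layer (common-window (∈-window⁻ layer v∈x) (∈-window⁻ layer w∈x))

∣B∩nearLayers∣≤3k : (layer : Fin n → ℕ) (B : Subset n) {k : ℕ} →
  (∀ i → ∣ B ∩ layerSet layer i ∣ ≤ k) → ∀ L → ∣ B ∩ nearLayers layer L ∣ ≤ 3 * k
∣B∩nearLayers∣≤3k layer B {k} perLayer L = begin
  ∣ B ∩ ((S (L ∸ 1) ∪ S L) ∪ S (suc L)) ∣             ≤⟨ ∣B∩[p∪q]∣≤ B _ _ ⟩
  ∣ B ∩ (S (L ∸ 1) ∪ S L) ∣ + ∣ B ∩ S (suc L) ∣      ≤⟨ +-mono-≤ (∣B∩[p∪q]∣≤ B _ _) ≤-refl ⟩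
  ∣ B ∩ S (L ∸ 1) ∣ + ∣ B ∩ S L ∣ + ∣ B ∩ S (suc L) ∣ ≤⟨ +-mono-≤ (+-mono-≤ (perLayer _) (perLayer _)) (perLayer _) ⟩
  k + k + k                                          ≡⟨ thrice k ⟩
  3 * k                                              ∎
  where
  open ≤-Reasoning
  S : ℕ → Subset _
  S = layerSet layer
  thrice : ∀ m → m + m + m ≡ 3 * m
  thrice = solve-∀

lemma6 : (G : Graph) (k : ℕ) → LayeredTreewidth G k →
    Σ (PathDecomp G) λ P → Σ (TreeDecomp G) λ T → Domino P ×
      (∀ (v : Fin (Graph.n G)) x → ∣ TreeDecomp.bag T x ∩ Gv P v ∣ ≤ 3 * k)
lemma6 G k ((T , layer , isLayering , layeredWidth) , _) = path , T , domino , bound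
  where
  open WindowPath G layer isLayering using (path; domino; Gv⊆nearLayers)

  bound : ∀ v x → ∣ TreeDecomp.bag T x ∩ Gv path v ∣ ≤ 3 * k
  bound v x = ≤-trans (∣B∩p∣≤∣B∩q∣ (TreeDecomp.bag T x) (Gv⊆nearLayers v))
                      (∣B∩nearLayers∣≤3k layer (TreeDecomp.bag T x) (layeredWidth x) (layer v))
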